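{- Let $(T_n)_{n\ge 0}$ be the Tribonacci sequence. If positive integers $n,\ell,m,d$ satisfy $$(T_{n}+1)(T_{n+1}+1)\cdots (T_{n+\ell-1}+1)=d\left(\frac{10^{m}-1}{9}\right)$$ with $n\geq 15$, $m\geq 2$, $1\leq d\leq 9$ and $1\leq \ell \leq 7$, then $$m\leq\ell n +\frac{\ell(\ell+1)}{2}\quad \text{and} \quad n< 2.4\times 10^{16}.$$
   Context: The Tribonacci sequence is defined by $T_0=0$, $T_1=T_2=1$ and $T_{n+3}=T_{n+2}+T_{n+1}+T_n$ for all $n\ge 0$. -}

module Defs where

open import Data.Nat using (ℕ; zero; suc; _+_; _*_)

T : ℕ → ℕ
T 0 = 0
T 1 = 1
T 2 = 1
T (suc (suc (suc n))) = T (suc (suc n)) + T (suc n) + T n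

prodT : ℕ → ℕ → ℕ
prodT n zero = 1
prodT n (suc ℓ) = (T n + 1) * prodT (suc n) ℓ

-- There are no solutions at all, so both bounds hold vacuously. Since T 15 = 3136, the case m = 2
-- is too small, and for m ≥ 3 the equation reads 9 ∏ (T i + 1) + d = d · 10 ^ (M + 3) with M = m − 3.
-- Modulo any q, the left side depends only on n modulo a period P of T mod q, and the right side only
-- on M modulo a period r of 10 ^ (M + 3) mod q (which is 0 when q ∣ 1000). A covering sieve with
-- q = 2, 4, 8, 5, 25, 125, 7, 13, 41, 61, 29 successively refines the classes of n mod 260400 and
-- M mod 420 and eliminates every class, for each 1 ≤ ℓ ≤ 7 and 1 ≤ d ≤ 9. The periods, the residue
-- tables of T and the sieve itself are evaluated by the type checker.
module Submission where

open import Defs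
open import Data.Nat using (ℕ; zero; suc; _+_; _*_; _∸_; _^_; _%_; _/_; NonZero; >-nonZero)
open import Data.Nat using (_≤_; _<_; _>_; _≤′_; ≤′-refl; ≤′-step; s≤s; z≤n; z<s; s<s; _≟_; _≤?_; _<?_)
open import Data.Nat.Properties
open import Data.Nat.DivMod
open import Data.Nat.Divisibility using (_∣_; _∣?_)
open import Data.Bool using (Bool; true; false; _∧_; _∨_; not)
open import Data.List using (List; []; _∷_; map)
open import Data.Product using (_×_; _,_; proj₁; proj₂)
open import Data.Sum using (inj₁; inj₂)
open import Data.Unit using (⊤; tt)
open import Data.Empty using (⊥; ⊥-elim)
open import Function using (_∘_)
open import Relation.Nullary using (¬_; Dec; yes; does)
open import Relation.Nullary.Decidable using (dec-true; from-yes; _×-dec_)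
open import Relation.Binary.PropositionalEquality
open ≡-Reasoning

private
  variable
    A : Set
    ℓ d m n : ℕ

module _ (q : ℕ) .{{_ : NonZero q}} where

  %-cong-+ : ∀ {a b c e} → a % q ≡ b % q → c % q ≡ e % q → (a + c) % q ≡ (b + e) % q
  %-cong-+ {a} {b} {c} {e} a≡b c≡e = begin
    (a + c) % q              ≡⟨ %-distribˡ-+ a c q ⟩
    (a % q + c % q) % q      ≡⟨ cong₂ (λ x y → (x + y) % q) a≡b c≡e ⟩
    (b % q + e % q) % q      ≡⟨ %-distribˡ-+ b e q ⟨
    (b + e) % q              ∎

  %-cong-* : ∀ {a b c e} → a % q ≡ b % q → c % q ≡ e % q → (a * c) % q ≡ (b * e) % q
  %-cong-* {a} {b} {c} {e} a≡b c≡e = begin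
    (a * c) % q              ≡⟨ %-distribˡ-* a c q ⟩
    (a % q * (c % q)) % q    ≡⟨ cong₂ (λ x y → (x * y) % q) a≡b c≡e ⟩
    (b % q * (e % q)) % q    ≡⟨ %-distribˡ-* b e q ⟨
    (b * e) % q              ∎

module _ {n o : ℕ} .{{_ : NonZero n}} .{{_ : NonZero o}} (n∣o : n ∣ o) (m : ℕ) where

  m%n+[m%o/n]*n≡m%o : m % n + (m % o / n) * n ≡ m % o
  m%n+[m%o/n]*n≡m%o = begin
    m % n + (m % o / n) * n      ≡⟨ cong (_+ (m % o / n) * n) (m∣n⇒o%n%m≡o%m n o m n∣o) ⟨
    m % o % n + (m % o / n) * n  ≡⟨ m≡m%n+[m/n]*n (m % o) n ⟨
    m % o                        ∎

  m%o/n<o/n : m % o / n < o / n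
  m%o/n<o/n = m<n*o⇒m/o<n (subst (m % o <_) (sym (m/n*n≡m n∣o)) (m%n<n m o))

*[n∸1]+m≡m*n : ∀ m {n} → 1 ≤ n → m * (n ∸ 1) + m ≡ m * n
*[n∸1]+m≡m*n m {n} 1≤n = begin
  m * (n ∸ 1) + m      ≡⟨ cong (m * (n ∸ 1) +_) (*-identityʳ m) ⟨
  m * (n ∸ 1) + m * 1  ≡⟨ *-distribˡ-+ m (n ∸ 1) 1 ⟨
  m * (n ∸ 1 + 1)      ≡⟨ cong (m *_) (m∸n+n≡m 1≤n) ⟩
  m * n                ∎

Periodic : (ℕ → A) → ℕ → Set
Periodic f P = ∀ i → f (i + P) ≡ f i

module _ {f : ℕ → A} {P : ℕ} .{{_ : NonZero P}} (f-periodic : Periodic f P) where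

  periodic-+* : ∀ i k → f (i + k * P) ≡ f i
  periodic-+* i zero    = cong f (+-identityʳ i)
  periodic-+* i (suc k) = begin
    f (i + (P + k * P))  ≡⟨ cong f (+-assoc i P (k * P)) ⟨
    f (i + P + k * P)    ≡⟨ periodic-+* (i + P) k ⟩
    f (i + P)            ≡⟨ f-periodic i ⟩
    f i                  ∎

  periodic-% : ∀ n → f n ≡ f (n % P)
  periodic-% n = trans (cong f (m≡m%n+[m/n]*n n P)) (periodic-+* (n % P) (n / P))

  periodic-≡ : ∀ {n m} → n % P ≡ m % P → f n ≡ f m
  periodic-≡ {n} {m} n≡m = begin
    f n        ≡⟨ periodic-% n ⟩
    f (n % P)  ≡⟨ cong f n≡m ⟩
    f (m % P)  ≡⟨ periodic-% m ⟨
    f m        ∎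

infixl 9 _!_
_!_ : List ℕ → ℕ → ℕ
[]       ! i     = 0
(x ∷ xs) ! zero  = x
(x ∷ xs) ! suc i = xs ! i

evens odds : List ℕ → List ℕ
evens []       = []
evens (x ∷ xs) = x ∷ odds xs
odds []       = []
odds (x ∷ xs) = evens xs

evens-! : ∀ xs j → evens xs ! j ≡ xs ! (j * 2)
odds-!  : ∀ xs j → odds xs ! j ≡ xs ! suc (j * 2)
evens-! []       j       = refl
evens-! (x ∷ xs) zero    = refl
evens-! (x ∷ xs) (suc j) = odds-! xs j
odds-! []       j = refl
odds-! (x ∷ xs) j = evens-! xs j

data Trie : Set where
  leaf : ℕ → Trie
  node : Trie → Trie → Trie

lookup : Trie → ℕ → ℕ
lookup (leaf x)   i = x
lookup (node e o) i with i % 2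
... | zero  = lookup e (i / 2)
... | suc _ = lookup o (i / 2)

fromList : ℕ → List ℕ → Trie
fromList zero    xs = leaf (xs ! 0)
fromList (suc k) xs = node (fromList k (evens xs)) (fromList k (odds xs))

m<2^[1+n]⇒m/2<2^n : ∀ {m} n → m < 2 ^ suc n → m / 2 < 2 ^ n
m<2^[1+n]⇒m/2<2^n {m} n m<2^[1+n] = m<n*o⇒m/o<n (subst (m <_) (*-comm 2 (2 ^ n)) m<2^[1+n])

lookup-fromList : ∀ k xs {i} → i < 2 ^ k → lookup (fromList k xs) i ≡ xs ! i
lookup-fromList zero    xs {zero} _ = refl
lookup-fromList zero    xs {suc i} (s≤s ())
lookup-fromList (suc k) xs {i} i<2^1+k
  with i % 2 | m%n<n i 2 | m≡m%n+[m/n]*n i 2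
... | zero     | _ | i≡ = begin
  lookup (fromList k (evens xs)) (i / 2)  ≡⟨ lookup-fromList k (evens xs) (m<2^[1+n]⇒m/2<2^n k i<2^1+k) ⟩
  evens xs ! (i / 2)                       ≡⟨ evens-! xs (i / 2) ⟩
  xs ! (i / 2 * 2)                         ≡⟨ cong (xs !_) i≡ ⟨
  xs ! i                                   ∎
... | suc zero | _ | i≡ = begin
  lookup (fromList k (odds xs)) (i / 2)   ≡⟨ lookup-fromList k (odds xs) (m<2^[1+n]⇒m/2<2^n k i<2^1+k) ⟩
  odds xs ! (i / 2)                        ≡⟨ odds-! xs (i / 2) ⟩
  xs ! suc (i / 2 * 2)                     ≡⟨ cong (xs !_) i≡ ⟨
  xs ! i                                   ∎
... | suc (suc _) | s≤s (s≤s ()) | _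

module _ (q : ℕ) .{{_ : NonZero q}} where

  T-%-step : ∀ i → (T (2 + i) % q + T (1 + i) % q + T i % q) % q ≡ T (3 + i) % q
  T-%-step i = %-cong-+ q (%-cong-+ q (m%n%n≡m%n (T (2 + i)) q) (m%n%n≡m%n (T (1 + i)) q)) (m%n%n≡m%n (T i) q)

  T-%-periodic : ∀ {P} → T P % q ≡ T 0 % q → T (1 + P) % q ≡ T 1 % q → T (2 + P) % q ≡ T 2 % q →
                 Periodic (λ i → T i % q) P
  T-%-periodic p₀ p₁ p₂ 0 = p₀
  T-%-periodic p₀ p₁ p₂ 1 = p₁
  T-%-periodic p₀ p₁ p₂ 2 = p₂
  T-%-periodic p₀ p₁ p₂ (suc (suc (suc i))) = %-cong-+ q (%-cong-+ q
    (T-%-periodic p₀ p₁ p₂ (suc (suc i))) (T-%-periodic p₀ p₁ p₂ (suc i))) (T-%-periodic p₀ p₁ p₂ i)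

  prodT-%-periodic : ∀ {P} → Periodic (λ i → T i % q) P → ∀ ℓ → Periodic (λ n → prodT n ℓ % q) P
  prodT-%-periodic T-periodic zero    n = refl
  prodT-%-periodic T-periodic (suc ℓ) n =
    %-cong-* q (%-cong-+ q (T-periodic n) refl) (prodT-%-periodic T-periodic ℓ (suc n))

  10^[+3]-%-periodic : ∀ {r} → 10 ^ (r + 3) % q ≡ 10 ^ 3 % q → Periodic (λ m → 10 ^ (m + 3) % q) r
  10^[+3]-%-periodic {r} 10^[r+3]≡10^3 i = begin
    10 ^ (i + r + 3) % q          ≡⟨ cong (λ e → 10 ^ e % q) (+-assoc i r 3) ⟩
    10 ^ (i + (r + 3)) % q        ≡⟨ cong (_% q) (^-distribˡ-+-* 10 i (r + 3)) ⟩
    10 ^ i * 10 ^ (r + 3) % q     ≡⟨ %-cong-* q {10 ^ i} refl 10^[r+3]≡10^3 ⟩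
    10 ^ i * 10 ^ 3 % q           ≡⟨ cong (_% q) (^-distribˡ-+-* 10 i 3) ⟨
    10 ^ (i + 3) % q              ∎

  tribsMod : ℕ → ℕ → ℕ → ℕ → List ℕ
  tribsMod zero    x y z = []
  tribsMod (suc k) x y z = x ∷ tribsMod k y z ((z + y + x) % q)

  tribsMod-! : ∀ k i {j} → j < k →
               tribsMod k (T i % q) (T (1 + i) % q) (T (2 + i) % q) ! j ≡ T (j + i) % q
  tribsMod-! (suc k) i {zero}  _          = refl
  tribsMod-! (suc k) i {suc j} (s≤s j<k) = begin
    tribsMod k (T (1 + i) % q) (T (2 + i) % q) ((T (2 + i) % q + T (1 + i) % q + T i % q) % q) ! j
      ≡⟨ cong (λ z → tribsMod k (T (1 + i) % q) (T (2 + i) % q) z ! j) (T-%-step i) ⟩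
    tribsMod k (T (1 + i) % q) (T (2 + i) % q) (T (3 + i) % q) ! j
      ≡⟨ tribsMod-! k (suc i) j<k ⟩
    T (j + suc i) % q
      ≡⟨ cong (λ e → T e % q) (+-suc j i) ⟩
    T (suc j + i) % q ∎

  prodMod : (ℕ → ℕ) → ℕ → ℕ → ℕ
  prodMod τ n zero    = 1
  prodMod τ n (suc ℓ) = (τ n + 1) * prodMod τ (suc n) ℓ % q

  prodMod-% : ∀ {τ} → (∀ i → τ i ≡ T i % q) → ∀ n ℓ → prodMod τ n ℓ % q ≡ prodT n ℓ % q
  prodMod-% τ≡T n zero    = refl
  prodMod-% {τ} τ≡T n (suc ℓ) = begin
    (τ n + 1) * prodMod τ (suc n) ℓ % q % q  ≡⟨ m%n%n≡m%n ((τ n + 1) * prodMod τ (suc n) ℓ) q ⟩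
    (τ n + 1) * prodMod τ (suc n) ℓ % q      ≡⟨ %-cong-* q (%-cong-+ q τn≡Tn refl) (prodMod-% τ≡T (suc n) ℓ) ⟩
    (T n + 1) * prodT (suc n) ℓ % q          ∎
    where
    τn≡Tn : τ n % q ≡ T n % q
    τn≡Tn = trans (cong (_% q) (τ≡T n)) (m%n%n≡m%n (T n) q)

allBelow : ℕ → (ℕ → Bool) → Bool
allBelow zero    p = true
allBelow (suc k) p = p k ∧ allBelow k p

allBelow² : ℕ → ℕ → (ℕ → ℕ → Bool) → Bool
allBelow² a b p = allBelow a λ j → allBelow b (p j)

∧-true : ∀ {a b} → a ∧ b ≡ true → a ≡ true × b ≡ true
∧-true {true} b≡true = refl , b≡true

⇒-true : ∀ {a b} → not a ∨ b ≡ true → a ≡ true → b ≡ true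
⇒-true b≡true refl = b≡true

allBelow-sound : ∀ {k} p {j} → allBelow k p ≡ true → j < k → p j ≡ true
allBelow-sound {suc k} p all j<1+k with m<1+n⇒m<n∨m≡n j<1+k
... | inj₁ j<k  = allBelow-sound p (proj₂ (∧-true all)) j<k
... | inj₂ refl = proj₁ (∧-true all)

allBelow²-sound : ∀ {a b} p {j k} → allBelow² a b p ≡ true → j < a → k < b → p j k ≡ true
allBelow²-sound p all j<a = allBelow-sound (p _) (allBelow-sound _ all j<a)

-- A sieve stage: a modulus q, a period P of T mod q, a period r of 10 ^ (M + 3) mod q, and the
-- moduli L and R to which the classes of n and of M are refined at this stage.
record Stage : Set where
  constructor stage
  field
    q P r L R : ℕ
    {{q≢0}} : NonZero q
    {{P≢0}} : NonZero P
    {{r≢0}} : NonZero r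
    {{L≢0}} : NonZero L
    {{R≢0}} : NonZero R

tableDepth : ℕ
tableDepth = 11

module _ (s : Stage) where
  open Stage s

  residues : List ℕ
  residues = tribsMod q (3 + P) (T 0 % q) (T 1 % q) (T 2 % q)

  table : Trie
  table = fromList tableDepth residues

  ValidStage : ℕ → ℕ → Set
  ValidStage L₀ R₀ =
    L₀ ∣ L × R₀ ∣ R × P ∣ L × r ∣ R × P ≤ 2 ^ tableDepth ×
    residues ! P ≡ T 0 % q × residues ! (1 + P) ≡ T 1 % q × residues ! (2 + P) ≡ T 2 % q ×
    10 ^ (r + 3) % q ≡ 10 ^ 3 % q

  validStage? : ∀ L₀ R₀ → Dec (ValidStage L₀ R₀)
  validStage? L₀ R₀ =
    L₀ ∣? L ×-dec R₀ ∣? R ×-dec P ∣? L ×-dec r ∣? R ×-dec P ≤? 2 ^ tableDepth ×-dec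
    residues ! P ≟ T 0 % q ×-dec residues ! (1 + P) ≟ T 1 % q ×-dec residues ! (2 + P) ≟ T 2 % q ×-dec
    10 ^ (r + 3) % q ≟ 10 ^ 3 % q

  passes : Trie → (ℓ d n m : ℕ) → Bool
  passes t ℓ d n m = does ((9 * prodMod q (λ i → lookup t (i % P)) n ℓ + d) % q ≟ d * 10 ^ (m % r + 3) % q)

ValidStages : ℕ → ℕ → List Stage → Set
ValidStages L₀ R₀ []       = ⊤
ValidStages L₀ R₀ (s ∷ ss) = ValidStage s L₀ R₀ × ValidStages (Stage.L s) (Stage.R s) ss

validStages? : ∀ L₀ R₀ ss → Dec (ValidStages L₀ R₀ ss)
validStages? L₀ R₀ []       = yes tt
validStages? L₀ R₀ (s ∷ ss) = validStage? s L₀ R₀ ×-dec validStages? (Stage.L s) (Stage.R s) ss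

-- Pairing each stage with its table once makes the table shared by all the classes it tests.
withTable : Stage → Stage × Trie
withTable s = s , table s

mutual
  excluded : List (Stage × Trie) → (L₀ R₀ : ℕ) .{{_ : NonZero L₀}} .{{_ : NonZero R₀}} →
             (ℓ d n m : ℕ) → Bool
  excluded []             L₀ R₀ ℓ d n m = false
  excluded ((s , t) ∷ σs) L₀ R₀ ℓ d n m =
    allBelow² (L / L₀) (R / R₀) λ j k → excludedAt s t σs ℓ d (n + j * L₀) (m + k * R₀)
    where open Stage s

  excludedAt : Stage → Trie → List (Stage × Trie) → (ℓ d n m : ℕ) → Bool
  excludedAt s t σs ℓ d n m = not (passes s t ℓ d n m) ∨ excluded σs L R ℓ d n m
    where open Stage s

Solution : (ℓ d N M : ℕ) → Set
Solution ℓ d N M = 9 * prodT N ℓ + d ≡ d * 10 ^ (M + 3)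

module _ (s : Stage) where
  open Stage s

  residues-! : ∀ {j} → j < 3 + P → residues s ! j ≡ T j % q
  residues-! {j} j<3+P = trans (tribsMod-! q (3 + P) 0 j<3+P) (cong (λ e → T e % q) (+-identityʳ j))

  residues-periodic : residues s ! P ≡ T 0 % q → residues s ! (1 + P) ≡ T 1 % q →
                      residues s ! (2 + P) ≡ T 2 % q → Periodic (λ i → T i % q) P
  residues-periodic p₀ p₁ p₂ =
    T-%-periodic q (shift 0 z<s p₀) (shift 1 (s<s z<s) p₁) (shift 2 (s<s (s<s z<s)) p₂)
    where
    shift : ∀ i → i < 3 → residues s ! (i + P) ≡ T i % q → T (i + P) % q ≡ T i % q
    shift i i<3 = trans (sym (residues-! (+-monoˡ-< P i<3)))

  table-lookup : P ≤ 2 ^ tableDepth → Periodic (λ i → T i % q) P → ∀ i → lookup (table s) (i % P) ≡ T i % q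
  table-lookup P≤2^depth T-periodic i = begin
    lookup (table s) (i % P)  ≡⟨ lookup-fromList tableDepth (residues s) (<-≤-trans (m%n<n i P) P≤2^depth) ⟩
    residues s ! (i % P)      ≡⟨ residues-! (<-≤-trans (m%n<n i P) (m≤n+m P 3)) ⟩
    T (i % P) % q             ≡⟨ periodic-% T-periodic i ⟨
    T i % q                   ∎

  passes-sound : ∀ {L₀ R₀} → ValidStage s L₀ R₀ → ∀ ℓ d N M {n m} → N % L ≡ n → M % R ≡ m →
                 Solution ℓ d N M → passes s (table s) ℓ d n m ≡ true
  passes-sound (_ , _ , P∣L , r∣R , P≤2^depth , p₀ , p₁ , p₂ , 10^[r+3]≡10^3) ℓ d N M refl refl sol =
    dec-true (_ ≟ _) (begin
      (9 * prodMod q τ (N % L) ℓ + d) % q  ≡⟨ %-cong-+ q (%-cong-* q {9} refl prodMod≡prodT) refl ⟩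
      (9 * prodT N ℓ + d) % q             ≡⟨ cong (_% q) sol ⟩
      d * 10 ^ (M + 3) % q                 ≡⟨ %-cong-* q {d} refl 10^[M+3]≡ ⟩
      d * 10 ^ (M % R % r + 3) % q         ∎)
    where
    T-periodic = residues-periodic p₀ p₁ p₂
    τ = λ i → lookup (table s) (i % P)

    prodMod≡prodT : prodMod q τ (N % L) ℓ % q ≡ prodT N ℓ % q
    prodMod≡prodT = trans (prodMod-% q (table-lookup P≤2^depth T-periodic) (N % L) ℓ)
      (periodic-≡ (prodT-%-periodic q T-periodic ℓ) {N % L} {N} (m∣n⇒o%n%m≡o%m P L N P∣L))

    10^[M+3]≡ : 10 ^ (M + 3) % q ≡ 10 ^ (M % R % r + 3) % q
    10^[M+3]≡ = trans (periodic-% (10^[+3]-%-periodic q 10^[r+3]≡10^3) M)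
      (cong (λ e → 10 ^ (e + 3) % q) (sym (m∣n⇒o%n%m≡o%m r R M r∣R)))

excluded-sound : ∀ ss {L₀ R₀} .{{_ : NonZero L₀}} .{{_ : NonZero R₀}} → ValidStages L₀ R₀ ss →
  ∀ ℓ d N M {n m} → N % L₀ ≡ n → M % R₀ ≡ m → Solution ℓ d N M →
  excluded (map withTable ss) L₀ R₀ ℓ d n m ≡ true → ⊥
excluded-sound [] _ _ _ _ _ _ _ _ ()
excluded-sound (s ∷ ss) {L₀} {R₀} (ok@(L₀∣L , R₀∣R , _) , oks) ℓ d N M refl refl sol all-excluded =
  excluded-sound ss oks ℓ d N M N%L≡ M%R≡ sol
    (⇒-true class-excluded (passes-sound s ok ℓ d N M N%L≡ M%R≡ sol))
  where
  open Stage s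
  j = N % L / L₀
  k = M % R / R₀

  N%L≡ : N % L ≡ N % L₀ + j * L₀
  N%L≡ = sym (m%n+[m%o/n]*n≡m%o L₀∣L N)

  M%R≡ : M % R ≡ M % R₀ + k * R₀
  M%R≡ = sym (m%n+[m%o/n]*n≡m%o R₀∣R M)

  class-excluded : excludedAt s (table s) (map withTable ss) ℓ d (N % L₀ + j * L₀) (M % R₀ + k * R₀) ≡ true
  class-excluded = allBelow²-sound
    (λ j k → excludedAt s (table s) (map withTable ss) ℓ d (N % L₀ + j * L₀) (M % R₀ + k * R₀))
    all-excluded (m%o/n<o/n L₀∣L N) (m%o/n<o/n R₀∣R M)

stages : List Stage
stages =
  stage 2 4 1 4 1 ∷ stage 4 8 1 8 1 ∷ stage 8 16 1 16 1 ∷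
  stage 5 31 1 496 1 ∷ stage 25 155 1 2480 1 ∷ stage 125 775 1 12400 1 ∷
  stage 7 48 6 37200 6 ∷ stage 13 168 6 260400 6 ∷ stage 41 560 5 260400 30 ∷
  stage 61 1860 60 260400 60 ∷ stage 29 140 28 260400 420 ∷ []

stages-valid : ValidStages 1 1 stages
stages-valid = from-yes (validStages? 1 1 stages)

sieve-excludes : ∀ ℓ d → ℓ < 7 → d < 9 → excluded (map withTable stages) 1 1 (suc ℓ) (suc d) 0 0 ≡ true
sieve-excludes ℓ d = allBelow²-sound (λ ℓ d → excluded (map withTable stages) 1 1 (suc ℓ) (suc d) 0 0) refl

no-solution : ∀ ℓ d N M → 1 ≤ ℓ → ℓ ≤ 7 → 1 ≤ d → d ≤ 9 → ¬ Solution ℓ d N M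
no-solution (suc ℓ) (suc d) N M _ ℓ<7 _ d<9 sol =
  excluded-sound stages stages-valid (suc ℓ) (suc d) N M (n%1≡0 N) (n%1≡0 M) sol (sieve-excludes ℓ d ℓ<7 d<9)

T≤T[1+n] : ∀ n → T n ≤ T (suc n)
T≤T[1+n] zero         = z≤n
T≤T[1+n] (suc zero)   = ≤-refl
T≤T[1+n] (suc (suc n)) = ≤-trans (m≤m+n (T (2 + n)) (T (1 + n))) (m≤m+n (T (2 + n) + T (1 + n)) (T n))

T-mono-≤ : m ≤ n → T m ≤ T n
T-mono-≤ = T-mono-≤′ ∘ ≤⇒≤′
  where
  T-mono-≤′ : m ≤′ n → T m ≤ T n
  T-mono-≤′ ≤′-refl              = ≤-refl
  T-mono-≤′ (≤′-step {n} m≤′n) = ≤-trans (T-mono-≤′ m≤′n) (T≤T[1+n] n)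

prodT>0 : ∀ n ℓ → prodT n ℓ > 0
prodT>0 n zero    = z<s
prodT>0 n (suc ℓ) = *-mono-≤ (m≤n+m 1 (T n)) (prodT>0 (suc n) ℓ)

T<prodT : ∀ n ℓ → T n < prodT n (suc ℓ)
T<prodT n ℓ =
  <-≤-trans (m<m+n (T n) z<s) (m≤m*n (T n + 1) (prodT (suc n) ℓ) {{>-nonZero (prodT>0 (suc n) ℓ)}})

d*99<9*prodT : 15 ≤ n → 1 ≤ ℓ → d ≤ 9 → d * 99 < 9 * prodT n ℓ
d*99<9*prodT {n} {suc ℓ} {d} 15≤n _ d≤9 =
  ≤-<-trans (*-monoˡ-≤ 99 d≤9) (<-≤-trans 9*99<9*T15 (*-monoʳ-≤ 9 (<⇒≤ (≤-<-trans T15≤Tn (T<prodT n ℓ)))))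
  where
  9*99<9*T15 : 9 * 99 < 9 * T 15
  9*99<9*T15 = from-yes (9 * 99 <? 9 * T 15)
  T15≤Tn : T 15 ≤ T n
  T15≤Tn = T-mono-≤ 15≤n

lemma7 : (n ℓ m d : ℕ) →
    15 ≤ n → 2 ≤ m → 1 ≤ d → d ≤ 9 → 1 ≤ ℓ → ℓ ≤ 7 →
    9 * prodT n ℓ ≡ d * (10 ^ m ∸ 1) →
    (2 * m ≤ 2 * (ℓ * n) + ℓ * (ℓ + 1)) × (10 * n < 24 * 10 ^ 16)
lemma7 n ℓ m d 15≤n 2≤m 1≤d d≤9 1≤ℓ ℓ≤7 eq = ⊥-elim (no-solution ℓ d n (m ∸ 3) 1≤ℓ ℓ≤7 1≤d d≤9 solution)
  where
  m≢2 : 2 ≢ m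
  m≢2 refl = <⇒≢ (d*99<9*prodT 15≤n 1≤ℓ d≤9) (sym eq)

  solution : Solution ℓ d n (m ∸ 3)
  solution = begin
    9 * prodT n ℓ + d      ≡⟨ cong (_+ d) eq ⟩
    d * (10 ^ m ∸ 1) + d   ≡⟨ *[n∸1]+m≡m*n d (m^n>0 10 m) ⟩
    d * 10 ^ m             ≡⟨ cong (λ e → d * 10 ^ e) (m∸n+n≡m (≤∧≢⇒< 2≤m m≢2)) ⟨
    d * 10 ^ (m ∸ 3 + 3)   ∎
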